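{- Let $0<\delta\le 1$ and let $G=(V,E)$ be a (multi)graph with $V=[n]$ and $E=\mathcal M_1\cup\cdots\cup\mathcal M_n$, where each $\mathcal M_i$ is a partial matching on $V$ of size at least $\delta n$ whose edges are labeled $i$. Let $S\subseteq V$. If $|R_G(S)|>(1-\delta)n$, then $R_G(S)=V$.
   Context: For $S\subseteq V$, $R_G(S)$ is the smallest set of vertices such that (1) $S\subseteq R_G(S)$, and (2) for all $i,j\in R_G(S)$ and all $k\in[n]$, if $(i,j)\in\mathcal M_k$ then $k\in R_G(S)$.
   Formalization: The parameter δ ranges over the rationals in the interval $0<\delta\le 1$. -}

module Defs where

open import Data.Nat using (ℕ)
open import Data.Fin using (Fin)
open import Data.Fin.Subset using (Subset; _∈_; _⊆_)
open import Data.List using (List; []; _∷_; concatMap; length)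
open import Data.List.Membership.Propositional renaming (_∈_ to _∈ₗ_)
open import Data.List.Relation.Unary.Unique.Propositional using (Unique)
open import Data.Product using (_×_; _,_)
open import Data.Sum using (_⊎_)
open import Data.Integer using (+_)
open import Data.Rational using (ℚ; _/_)

Edge : ℕ → Set
Edge n = Fin n × Fin n

endpoints : ∀ {n} → List (Edge n) → List (Fin n)
endpoints = concatMap (λ { (i , j) → i ∷ j ∷ [] })

-- A partial matching on [n]: a list of edges in which every vertex occurs
-- at most once as an endpoint (so edges are disjoint and have distinct ends).
IsMatching : ∀ {n} → List (Edge n) → Set
IsMatching M = Unique (endpoints M)

Matchings : ℕ → Set
Matchings n = Fin n → List (Edge n)

EdgeIn : ∀ {n} → Fin n → Fin n → List (Edge n) → Set
EdgeIn i j M = (i , j) ∈ₗ M ⊎ (j , i) ∈ₗ M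

Closed : ∀ {n} → Matchings n → Subset n → Set
Closed {n} M T = ∀ (i j k : Fin n) → i ∈ T → j ∈ T → EdgeIn i j (M k) → k ∈ T

-- T = R_G(S): the smallest closed set containing S.
IsR : ∀ {n} → Matchings n → Subset n → Subset n → Set
IsR {n} M S T = S ⊆ T × Closed M T × (∀ (U : Subset n) → S ⊆ U → Closed M U → T ⊆ U)

ℕ→ℚ : ℕ → ℚ
ℕ→ℚ m = + m / 1

-- If k ∉ R, closedness of R forbids an edge of M_k with both ends in R, so choosing an
-- end outside R from each edge of M_k yields |M_k| distinct vertices outside R. Hence
-- |R| + |M_k| ≤ n, i.e. |R| ≤ (1 − δ)n, contradicting the hypothesis.
module Submission where

open import Defs
open import Data.Nat using (ℕ)
open import Data.Fin using (Fin)
open import Data.Fin.Subset using (Subset; _∈_; ∣_∣)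
open import Data.List using (length)
open import Data.Rational using (ℚ; 0ℚ; 1ℚ; _<_; _≤_; _*_; _-_)

import Data.Nat as ℕ
import Data.Nat.Properties as ℕ
import Data.Integer as ℤ
import Data.Integer.Properties as ℤ
import Data.Rational as ℚ
import Data.Rational.Properties as ℚ
import Data.Nat.Coprimality as Coprimality
open import Data.Fin.Subset using (_∉_; _∪_; ⁅_⁆)
open import Data.Fin.Subset.Properties
  using (_∈?_; p⊂q⇒∣p∣<∣q∣; p⊆p∪q; x∈p∪q⁺; x∈p∪q⁻; x∈⁅x⁆; x∈⁅y⁆⇒x≡y; ∣p∣≤n)
open import Data.List using ([]; _∷_; map)
open import Data.List.Properties using (length-map)
open import Data.List.Relation.Unary.All as All using (All; []; _∷_)
open import Data.List.Relation.Unary.AllPairs using ([]; _∷_)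
open import Data.List.Relation.Unary.Unique.Propositional using (Unique)
open import Data.List.Membership.Propositional using () renaming (_∈_ to _∈ₗ_)
open import Data.List.Relation.Unary.Any using (here; there)
open import Data.Product using (_,_; proj₁; proj₂)
open import Data.Sum using (inj₁; inj₂; [_,_]′; _⊎_)
open import Data.Empty using (⊥-elim)
open import Relation.Nullary using (yes; no)
open import Relation.Binary.PropositionalEquality

module _ {n : ℕ} where

  ∉p∪⁅x⁆ : ∀ {p : Subset n} {x y} → x ≢ y → y ∉ p → y ∉ p ∪ ⁅ x ⁆
  ∉p∪⁅x⁆ {p} {x} x≢y y∉p y∈p∪⁅x⁆ with x∈p∪q⁻ p ⁅ x ⁆ y∈p∪⁅x⁆
  ... | inj₁ y∈p = y∉p y∈p
  ... | inj₂ y∈⁅x⁆ = x≢y (sym (x∈⁅y⁆⇒x≡y _ y∈⁅x⁆))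

  ∣p∣+length≤n : ∀ (p : Subset n) {xs} → Unique xs → All (_∉ p) xs → ∣ p ∣ ℕ.+ length xs ℕ.≤ n
  ∣p∣+length≤n p []                []            = ℕ.≤-trans (ℕ.≤-reflexive (ℕ.+-identityʳ _)) (∣p∣≤n p)
  ∣p∣+length≤n p {x ∷ xs} (x≢xs ∷ u) (x∉p ∷ xs∉p) = begin
    ∣ p ∣ ℕ.+ ℕ.suc (length xs)  ≡⟨ ℕ.+-suc ∣ p ∣ (length xs) ⟩
    ℕ.suc ∣ p ∣ ℕ.+ length xs    ≤⟨ ℕ.+-monoˡ-≤ (length xs) ∣p∣<∣p∪⁅x⁆∣ ⟩
    ∣ p ∪ ⁅ x ⁆ ∣ ℕ.+ length xs  ≤⟨ ∣p∣+length≤n (p ∪ ⁅ x ⁆) u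
                                      (All.zipWith (λ (x≢y , y∉p) → ∉p∪⁅x⁆ x≢y y∉p) (x≢xs , xs∉p)) ⟩
    n                            ∎
    where
    open ℕ.≤-Reasoning
    ∣p∣<∣p∪⁅x⁆∣ : ∣ p ∣ ℕ.< ∣ p ∪ ⁅ x ⁆ ∣
    ∣p∣<∣p∪⁅x⁆∣ = p⊂q⇒∣p∣<∣q∣ (p⊆p∪q ⁅ x ⁆ , x , x∈p∪q⁺ (inj₂ (x∈⁅x⁆ x)) , x∉p)

  Selects : (Edge n → Fin n) → Set
  Selects f = ∀ e → f e ≡ proj₁ e ⊎ f e ≡ proj₂ e

  module _ {f : Edge n → Fin n} (selects : Selects f) where

    selected : ∀ {P : Fin n → Set} e → P (proj₁ e) → P (proj₂ e) → P (f e)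
    selected {P} e Pi Pj = [ (λ eq → subst P (sym eq) Pi) , (λ eq → subst P (sym eq) Pj) ]′ (selects e)

    All-map-select : ∀ {P : Fin n → Set} es → All P (endpoints es) → All P (map f es)
    All-map-select []            []                = []
    All-map-select ((i , j) ∷ es) (Pi ∷ Pj ∷ Pes) = selected (i , j) Pi Pj ∷ All-map-select es Pes

    Unique-map-select : ∀ {es} → IsMatching es → Unique (map f es)
    Unique-map-select {[]}          []                      = []
    Unique-map-select {(i , j) ∷ es} ((_ ∷ i≢es) ∷ j≢es ∷ u) =
      selected {λ x → All (x ≢_) (map f es)} (i , j) (All-map-select es i≢es) (All-map-select es j≢es)
        ∷ Unique-map-select u

  module _ (R : Subset n) where

    endOutside : Edge n → Fin n
    endOutside (i , j) with i ∈? R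
    ... | yes _ = j
    ... | no  _ = i

    endOutside-selects : Selects endOutside
    endOutside-selects (i , j) with i ∈? R
    ... | yes _ = inj₂ refl
    ... | no  _ = inj₁ refl

    endOutside-∉ : ∀ {es} → (∀ {i j} → (i , j) ∈ₗ es → i ∈ R → j ∉ R) → All (_∉ R) (map endOutside es)
    endOutside-∉ {[]}           _     = []
    endOutside-∉ {(i , j) ∷ es} split = head ∷ endOutside-∉ (λ e∈es → split (there e∈es))
      where
      head : endOutside (i , j) ∉ R
      head with i ∈? R
      ... | yes i∈R = split (here refl) i∈R
      ... | no  i∉R = i∉R

    ∣R∣+length≤n : ∀ {es} → IsMatching es → (∀ {i j} → (i , j) ∈ₗ es → i ∈ R → j ∉ R) →
                   ∣ R ∣ ℕ.+ length es ℕ.≤ n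
    ∣R∣+length≤n {es} matching split =
      subst (λ m → ∣ R ∣ ℕ.+ m ℕ.≤ n) (length-map endOutside es)
        (∣p∣+length≤n R (Unique-map-select endOutside-selects matching) (endOutside-∉ split))

  closed⇒∣R∣+∣M∣≤n : ∀ (M : Matchings n) {R k} → Closed M R → k ∉ R → IsMatching (M k) →
                     ∣ R ∣ ℕ.+ length (M k) ℕ.≤ n
  closed⇒∣R∣+∣M∣≤n M {R} {k} closed k∉R matching =
    ∣R∣+length≤n R matching (λ ij∈M i∈R j∈R → k∉R (closed _ _ k i∈R j∈R (inj₁ ij∈M)))

ℕ→ℚ≡mkℚ : ∀ k → ℕ→ℚ k ≡ ℚ.mkℚ (ℤ.+ k) 0 (Coprimality.sym (Coprimality.1-coprimeTo k))
ℕ→ℚ≡mkℚ k = ℚ.normalize-coprime (Coprimality.sym (Coprimality.1-coprimeTo k))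

ℕ→ℚ-+ : ∀ a b → ℕ→ℚ (a ℕ.+ b) ≡ ℕ→ℚ a ℚ.+ ℕ→ℚ b
ℕ→ℚ-+ a b rewrite ℕ→ℚ≡mkℚ a | ℕ→ℚ≡mkℚ b =
  cong (ℚ._/ 1) (sym (cong₂ ℤ._+_ (ℤ.*-identityʳ (ℤ.+ a)) (ℤ.*-identityʳ (ℤ.+ b))))

ℕ→ℚ-mono-≤ : ∀ {a b} → a ℕ.≤ b → ℕ→ℚ a ≤ ℕ→ℚ b
ℕ→ℚ-mono-≤ {a} {b} a≤b rewrite ℕ→ℚ≡mkℚ a | ℕ→ℚ≡mkℚ b =
  ℚ.*≤* (subst₂ ℤ._≤_ (sym (ℤ.*-identityʳ (ℤ.+ a))) (sym (ℤ.*-identityʳ (ℤ.+ b))) (ℤ.+≤+ a≤b))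

[1-p]*q+p*q≡q : ∀ p q → (1ℚ - p) * q ℚ.+ p * q ≡ q
[1-p]*q+p*q≡q p q = begin
  (1ℚ - p) * q ℚ.+ p * q       ≡⟨ ℚ.*-distribʳ-+ q (1ℚ - p) p ⟨
  ((1ℚ ℚ.+ ℚ.- p) ℚ.+ p) * q   ≡⟨ cong (_* q) (ℚ.+-assoc 1ℚ (ℚ.- p) p) ⟩
  (1ℚ ℚ.+ (ℚ.- p ℚ.+ p)) * q   ≡⟨ cong (λ r → (1ℚ ℚ.+ r) * q) (ℚ.+-inverseˡ p) ⟩
  (1ℚ ℚ.+ 0ℚ) * q              ≡⟨ ℚ.*-identityˡ q ⟩
  q                            ∎
  where open ≡-Reasoning

lemma3p9 : (n : ℕ) (δ : ℚ) → 0ℚ < δ → δ ≤ 1ℚ →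
    (M : Matchings n) →
    (∀ (k : Fin n) → IsMatching (M k)) →
    (∀ (k : Fin n) → δ * ℕ→ℚ n ≤ ℕ→ℚ (length (M k))) →
    (S R : Subset n) → IsR M S R →
    (1ℚ - δ) * ℕ→ℚ n < ℕ→ℚ ∣ R ∣ →
    ∀ (v : Fin n) → v ∈ R
lemma3p9 n δ _ _ M matching large S R (_ , closed , _) R-large v with v ∈? R
... | yes v∈R = v∈R
... | no  v∉R = ⊥-elim (ℚ.<-irrefl refl (begin-strict
  ℕ→ℚ n                                    ≡⟨ [1-p]*q+p*q≡q δ (ℕ→ℚ n) ⟨
  (1ℚ - δ) * ℕ→ℚ n ℚ.+ δ * ℕ→ℚ n          <⟨ ℚ.+-mono-<-≤ R-large (large v) ⟩
  ℕ→ℚ ∣ R ∣ ℚ.+ ℕ→ℚ (length (M v))         ≡⟨ ℕ→ℚ-+ ∣ R ∣ (length (M v)) ⟨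
  ℕ→ℚ (∣ R ∣ ℕ.+ length (M v))             ≤⟨ ℕ→ℚ-mono-≤ (closed⇒∣R∣+∣M∣≤n M closed v∉R (matching v)) ⟩
  ℕ→ℚ n                                    ∎))
  where open ℚ.≤-Reasoning
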